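{- Let $s\in\mathbb{N}$ and let $T$ be a digraph. Let $x_1,\dots,x_k,y_1,\dots,y_k$ be distinct vertices of $T$, and let $\mathcal{Q}_1,\dots,\mathcal{Q}_k$ be (possibly empty) path systems in $T-\{x_1,\dots,x_k,y_1,\dots,y_k\}$ with $E(\mathcal{Q}_i)\cap E(\mathcal{Q}_j)=\emptyset$ whenever $i\ne j$. Let $$m:=k+\sum_{i=1}^k|\mathcal{Q}_i|+\Bigl|\bigcup_{i=1}^k V(\mathcal{Q}_i)\Bigr|,$$ and suppose $T$ is $2sm$-linked. Then there exist edge-disjoint paths $P_1,\dots,P_k\subseteq T$ such that: (i) $P_i$ is a path from $x_i$ to $y_i$ for all $i\in[k]$; (ii) $Q\subseteq P_i$ for all $Q\in\mathcal{Q}_i$ and all $i\in[k]$; (iii) $V(P_i)\cap V(P_j)\subseteq V(\mathcal{Q}_i)\cap V(\mathcal{Q}_j)$ for all $i\ne j$; (iv) $|P_1\cup\dots\cup P_k|\le |T|/s+|V(\mathcal{Q}_1)\cup\dots\cup V(\mathcal{Q}_k)|$.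
   Context: Digraphs have no loops and at most one edge in each direction between two vertices. A path system is a collection of vertex-disjoint directed paths; $|\mathcal{Q}|$ is its number of paths and $V(\mathcal{Q})$, $E(\mathcal{Q})$ are the vertices and edges on its paths. A digraph $D$ is $m'$-linked if $|D|\ge 2m'$ and whenever $u_1,\dots,u_{m'},w_1,\dots,w_{m'}$ are $2m'$ distinct vertices of $D$, there exist vertex-disjoint directed paths with the $i$-th from $u_i$ to $w_i$. $|P_1\cup\dots\cup P_k|$ and $|T|$ denote numbers of vertices. -}

module Defs where

open import Data.Nat using (ℕ; _+_; _*_; _≤_)
open import Data.Fin using (Fin; _≟_)
open import Data.List using (List; []; _∷_; length; head; last; map; allFin; concat; concatMap; deduplicate)
open import Data.List.Membership.Propositional using (_∈_; _∉_)
open import Data.List.Relation.Unary.Any using (Any)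
open import Data.List.Relation.Unary.Linked using (Linked)
open import Data.List.Relation.Unary.AllPairs using (AllPairs)
open import Data.List.Relation.Unary.Unique.Propositional using (Unique)
open import Data.Maybe using (just)
open import Data.Product using (_×_; ∃)
open import Relation.Binary.PropositionalEquality using (_≡_; _≢_)
open import Relation.Nullary using (¬_)
open import Function.Definitions using (Injective)

-- A digraph on the vertex set Fin n: edges are ordered pairs (a relation), so
-- there is at most one edge in each direction; no loops.
record Digraph : Set₁ where
  field
    n        : ℕ
    E        : Fin n → Fin n → Set
    loopless : ∀ v → ¬ E v v
open Digraph public

∣_∣ᵥ : Digraph → ℕ
∣ D ∣ᵥ = n D

IsPath : (D : Digraph) → List (Fin (n D)) → Set
IsPath D p = Linked (E D) p × Unique p × ∃ λ v → head p ≡ just v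

PathFrom : (D : Digraph) → Fin (n D) → Fin (n D) → List (Fin (n D)) → Set
PathFrom D x y p = IsPath D p × head p ≡ just x × last p ≡ just y

data EdgeOf {A : Set} (u v : A) : List A → Set where
  here  : ∀ {xs} → EdgeOf u v (u ∷ v ∷ xs)
  there : ∀ {x xs} → EdgeOf u v xs → EdgeOf u v (x ∷ xs)

VDisjoint : {A : Set} → List A → List A → Set
VDisjoint p q = ∀ v → v ∈ p → v ∉ q

SubPath : {A : Set} → List A → List A → Set
SubPath q p = (∀ v → v ∈ q → v ∈ p) × (∀ u v → EdgeOf u v q → EdgeOf u v p)

IsPathSystem : (D : Digraph) → List (List (Fin (n D))) → Set
IsPathSystem D Q = (∀ p → p ∈ Q → IsPath D p) × AllPairs VDisjoint Q

_∈V_ : {A : Set} → A → List (List A) → Set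
v ∈V Q = Any (v ∈_) Q

EdgeOfSys : {A : Set} → A → A → List (List A) → Set
EdgeOfSys u v Q = Any (EdgeOf u v) Q

∣_∣ᵈ : {m : ℕ} → List (Fin m) → ℕ
∣ xs ∣ᵈ = length (deduplicate _≟_ xs)

Linked' : (D : Digraph) → ℕ → Set
Linked' D m' =
  2 * m' ≤ n D ×
  ((u w : Fin m' → Fin (n D)) → Injective _≡_ _≡_ u → Injective _≡_ _≡_ w →
   (∀ i j → u i ≢ w j) →
   ∃ λ (P : Fin m' → List (Fin (n D))) →
     (∀ i → PathFrom D (u i) (w i) (P i)) ×
     (∀ i j → i ≢ j → VDisjoint (P i) (P j)))

-- Each P i is woven from the pieces x i, the paths of Q i and y i, taken in this order, by
-- joining each consecutive pair (a , b) of pieces by a bridge: a path from an out-neighbour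
-- of a to an in-neighbour of b avoiding the set B of all terminals and all vertices of the
-- Q j. When all bridges are vertex-disjoint, (i)–(iii) follow directly.
-- The bridges come from the linkedness of T in two rounds. First each gap (a , b) gets
-- neighbours c of a and d of b, all distinct and outside B: link a to a fresh vertex and a
-- fresh vertex to b avoiding everything chosen so far, and take the second and the penultimate
-- vertex. Then the pairs (c , d) are linked avoiding B, after padding them to exactly M pairs;
-- every padding path has at least two vertices, so the bridges use at most |T| − 2M + 2g
-- vertices for g gaps. Doing this for s copies of every gap and keeping the cheapest copy
-- gives (iv).
module Submission where

open import Defs
open import Data.Nat using (ℕ; _+_; _*_; _≤_)
open import Data.Fin using (Fin)
open import Data.Nat.ListAction using (sum)
open import Data.List using (List; length; map; allFin; concat; concatMap)
open import Data.List.Membership.Propositional using (_∈_)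
open import Data.Product using (_×_; ∃)
open import Relation.Binary.PropositionalEquality using (_≡_; _≢_)
open import Relation.Nullary using (¬_)
open import Function.Definitions using (Injective)

open import Data.Nat using (zero; suc; _<_; z≤n; s≤s; s≤s⁻¹)
open import Data.Nat.Properties hiding (_≟_)
open import Data.Nat.Solver using (module +-*-Solver)
open import Data.Fin using (zero; suc; _≟_)
open import Data.Fin.Properties using (¬∀⟶∃¬)
open import Data.List using ([]; _∷_; _++_; replicate; filter; deduplicate; lookup; tabulate; head; last)
open import Data.List.Properties using (tabulate-lookup; ∷-injectiveˡ; ∷-injectiveʳ; length-filter; length-++; length-map; length-tabulate; map-tabulate; concat-++; concat-concat; ++-assoc; filter-notAll)
open import Data.List.Membership.Propositional using (_∉_; find; lose)
open import Data.List.Membership.Propositional.Properties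
open import Data.List.Relation.Binary.Subset.Propositional using (_⊆_)
open import Data.List.Relation.Binary.Disjoint.Propositional using (Disjoint)
open import Data.List.Relation.Binary.Pointwise using (Pointwise; []; _∷_)
import Data.List.Relation.Binary.Pointwise as Pointwise
open import Data.List.Relation.Binary.Pointwise.Properties using (Pointwise-length)
open import Data.List.Relation.Unary.Any using (here; there)
import Data.List.Relation.Unary.Any.Properties as Anyₚ
open import Data.List.Relation.Unary.All using (All; []; _∷_)
import Data.List.Relation.Unary.All as All
import Data.List.Relation.Unary.All.Properties as Allₚ
open import Data.List.Relation.Unary.AllPairs using (AllPairs; []; _∷_)
import Data.List.Relation.Unary.AllPairs as AllPairs
import Data.List.Relation.Unary.AllPairs.Properties as AllPairsₚ
open import Data.List.Relation.Unary.Linked using (Linked; []; [-]; _∷_)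
import Data.List.Relation.Unary.Linked.Properties as Linkedₚ
open import Data.List.Relation.Unary.Unique.Propositional using (Unique)
import Data.List.Relation.Unary.Unique.Propositional.Properties as Uniqueₚ
open import Data.Maybe using (just; fromMaybe)
open import Data.Maybe.Relation.Binary.Connected using (Connected; just)
open import Data.Product using (_,_; ∃₂; proj₁; proj₂)
open import Data.Sum using (_⊎_; inj₁; inj₂)
open import Data.Empty using (⊥-elim)
open import Relation.Nullary using (yes; no; ¬?; contradiction)
open import Relation.Binary.Definitions using (DecidableEquality)
open import Function using (id; _∘_)
open import Relation.Binary.PropositionalEquality using (module ≡-Reasoning; refl; sym; trans; cong; cong₂; subst; subst₂)

module _ {A : Set} where

  endpoints : List (A × A) → List A
  endpoints []              = []
  endpoints ((a , b) ∷ ps) = a ∷ b ∷ endpoints ps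

  endpoints-++ : ∀ (ps qs : List (A × A)) → endpoints (ps ++ qs) ≡ endpoints ps ++ endpoints qs
  endpoints-++ []              qs = refl
  endpoints-++ ((a , b) ∷ ps) qs = cong (λ zs → a ∷ b ∷ zs) (endpoints-++ ps qs)

  length-endpoints : ∀ (ps : List (A × A)) → length (endpoints ps) ≡ 2 * length ps
  length-endpoints []       = refl
  length-endpoints (_ ∷ ps) = cong suc (trans (cong suc (length-endpoints ps)) (sym (+-suc (length ps) (length ps + 0))))

  source∈endpoints : ∀ (ps : List (A × A)) i → proj₁ (lookup ps i) ∈ endpoints ps
  source∈endpoints (_ ∷ ps) zero    = here refl
  source∈endpoints (_ ∷ ps) (suc i) = there (there (source∈endpoints ps i))

  target∈endpoints : ∀ (ps : List (A × A)) i → proj₂ (lookup ps i) ∈ endpoints ps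
  target∈endpoints (_ ∷ ps) zero    = there (here refl)
  target∈endpoints (_ ∷ ps) (suc i) = there (there (target∈endpoints ps i))

  sources-injective : ∀ ps → Unique (endpoints ps) → Injective _≡_ _≡_ (proj₁ ∘ lookup ps)
  sources-injective (_ ∷ ps) _                 {zero}  {zero}  _  = refl
  sources-injective (_ ∷ ps) (a∉ ∷ _)          {zero}  {suc j} eq = ⊥-elim (All.lookup a∉ (there (source∈endpoints ps j)) eq)
  sources-injective (_ ∷ ps) (a∉ ∷ _)          {suc i} {zero}  eq = ⊥-elim (All.lookup a∉ (there (source∈endpoints ps i)) (sym eq))
  sources-injective (_ ∷ ps) (_ ∷ _ ∷ u)       {suc i} {suc j} eq = cong suc (sources-injective ps u eq)

  targets-injective : ∀ ps → Unique (endpoints ps) → Injective _≡_ _≡_ (proj₂ ∘ lookup ps)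
  targets-injective (_ ∷ ps) _                 {zero}  {zero}  _  = refl
  targets-injective (_ ∷ ps) (_ ∷ b∉ ∷ _)      {zero}  {suc j} eq = ⊥-elim (All.lookup b∉ (target∈endpoints ps j) eq)
  targets-injective (_ ∷ ps) (_ ∷ b∉ ∷ _)      {suc i} {zero}  eq = ⊥-elim (All.lookup b∉ (target∈endpoints ps i) (sym eq))
  targets-injective (_ ∷ ps) (_ ∷ _ ∷ u)       {suc i} {suc j} eq = cong suc (targets-injective ps u eq)

  source≢target : ∀ ps → Unique (endpoints ps) → ∀ i j → proj₁ (lookup ps i) ≢ proj₂ (lookup ps j)
  source≢target (_ ∷ ps) (a∉ ∷ _)     zero    zero    = All.lookup a∉ (here refl)
  source≢target (_ ∷ ps) (a∉ ∷ _)     zero    (suc j) = All.lookup a∉ (there (target∈endpoints ps j))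
  source≢target (_ ∷ ps) (_ ∷ b∉ ∷ _) (suc i) zero    = All.lookup b∉ (source∈endpoints ps i) ∘ sym
  source≢target (_ ∷ ps) (_ ∷ _ ∷ u)  (suc i) (suc j) = source≢target ps u i j

  AllPairs-++⁻ : ∀ {R : A → A → Set} xs {ys} → AllPairs R (xs ++ ys) →
                 AllPairs R xs × AllPairs R ys × (∀ {a b} → a ∈ xs → b ∈ ys → R a b)
  AllPairs-++⁻ []       rs        = [] , rs , λ ()
  AllPairs-++⁻ (x ∷ xs) (rx ∷ rs) with AllPairs-++⁻ xs rs
  ... | rxs , rys , cross = Allₚ.++⁻ˡ xs rx ∷ rxs , rys , λ
    { (here refl) b∈ → All.lookup (Allₚ.++⁻ʳ xs rx) b∈
    ; (there a∈)  b∈ → cross a∈ b∈ }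

  Unique-++⁻ : ∀ xs {ys : List A} → Unique (xs ++ ys) → Unique xs × Unique ys × Disjoint xs ys
  Unique-++⁻ xs u with AllPairs-++⁻ xs u
  ... | uxs , uys , cross = uxs , uys , λ (a∈ , a∈′) → cross a∈ a∈′ refl

  VDisjoint⇒Disjoint : ∀ {xs ys : List A} → VDisjoint xs ys → Disjoint xs ys
  VDisjoint⇒Disjoint d (v∈xs , v∈ys) = d _ v∈xs v∈ys

  Unique-concat⁺ : ∀ {σs : List (List A)} → All Unique σs → AllPairs VDisjoint σs → Unique (concat σs)
  Unique-concat⁺ us ds = Uniqueₚ.concat⁺ us (AllPairs.map VDisjoint⇒Disjoint ds)

  Unique-concat⁻ : ∀ (σs : List (List A)) → Unique (concat σs) → All Unique σs × AllPairs VDisjoint σs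
  Unique-concat⁻ []       _ = [] , []
  Unique-concat⁻ (σ ∷ σs) u with Unique-++⁻ σ u
  ... | uσ , uσs , disj with Unique-concat⁻ σs uσs
  ...   | us , ds = uσ ∷ us , All.tabulate (λ σ′∈ v v∈σ v∈σ′ → disj (v∈σ , ∈-concat⁺′ v∈σ′ σ′∈)) ∷ ds

  Pointwise-++⁻ : ∀ {B : Set} {R : A → B → Set} xs {ys zs} → Pointwise R (xs ++ ys) zs →
                  ∃₂ λ zs₁ zs₂ → zs ≡ zs₁ ++ zs₂ × Pointwise R xs zs₁ × Pointwise R ys zs₂
  Pointwise-++⁻ []       rs       = [] , _ , refl , [] , rs
  Pointwise-++⁻ (x ∷ xs) (r ∷ rs) with Pointwise-++⁻ xs rs
  ... | zs₁ , zs₂ , refl , rs₁ , rs₂ = _ ∷ zs₁ , zs₂ , refl , r ∷ rs₁ , rs₂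

  ⊆-shorter-prefix : ∀ (xs : List A) {ys pre rest} → xs ++ ys ≡ pre ++ rest → length xs ≤ length pre → xs ⊆ pre
  ⊆-shorter-prefix (x ∷ xs) {pre = p ∷ pre} eq (s≤s ≤pre) (here refl) = here (∷-injectiveˡ eq)
  ⊆-shorter-prefix (x ∷ xs) {pre = p ∷ pre} eq (s≤s ≤pre) (there v∈) =
    there (⊆-shorter-prefix xs (∷-injectiveʳ eq) ≤pre v∈)

  pairUp : ℕ → List A → List (A × A)
  pairUp zero    _            = []
  pairUp (suc d) (a ∷ b ∷ xs) = (a , b) ∷ pairUp d xs
  pairUp (suc d) _            = []

  pairUp-endpoints : ∀ d xs → 2 * d ≤ length xs →
                     length (pairUp d xs) ≡ d × ∃ λ rest → endpoints (pairUp d xs) ++ rest ≡ xs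
  pairUp-endpoints zero    xs           _ = refl , xs , refl
  pairUp-endpoints (suc d) []           ()
  pairUp-endpoints (suc d) (a ∷ [])     (s≤s 2d+1≤0) = contradiction (subst (_≤ 0) (+-suc d (d + 0)) 2d+1≤0) λ ()
  pairUp-endpoints (suc d) (a ∷ b ∷ xs) (s≤s 2d+1≤) with pairUp-endpoints d xs (s≤s⁻¹ (subst (_≤ suc (length xs)) (+-suc d (d + 0)) 2d+1≤))
  ... | len , rest , eq = cong suc len , rest , cong (λ zs → a ∷ b ∷ zs) eq

  ∈∧∉⇒≢ : ∀ {u v : A} {xs} → u ∈ xs → v ∉ xs → u ≢ v
  ∈∧∉⇒≢ u∈xs v∉xs refl = v∉xs u∈xs

  ++-comm-⊆ : ∀ (xs : List A) {ys} → xs ++ ys ⊆ ys ++ xs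
  ++-comm-⊆ xs {ys} v∈ with ∈-++⁻ xs v∈
  ... | inj₁ v∈xs = ∈-++⁺ʳ ys v∈xs
  ... | inj₂ v∈ys = ∈-++⁺ˡ v∈ys

  head⇒∈ : ∀ {xs : List A} {v} → head xs ≡ just v → v ∈ xs
  head⇒∈ {x ∷ xs} refl = here refl

  last⇒∈ : ∀ {xs : List A} {v} → last xs ≡ just v → v ∈ xs
  last⇒∈ {x ∷ []}     refl = here refl
  last⇒∈ {x ∷ y ∷ xs} eq   = there (last⇒∈ {y ∷ xs} eq)

  head-++ : ∀ (xs ys : List A) {v} → head xs ≡ just v → head (xs ++ ys) ≡ just v
  head-++ (x ∷ xs) ys eq = eq

  last-++ : ∀ (xs ys : List A) {v} → last ys ≡ just v → last (xs ++ ys) ≡ just v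
  last-++ []           ys       eq = eq
  last-++ (x ∷ [])     (y ∷ ys) eq = eq
  last-++ (x ∷ x′ ∷ xs) (y ∷ ys) eq = last-++ (x′ ∷ xs) (y ∷ ys) eq

  Linked⇒second : ∀ {R : A → A → Set} {xs : List A} {a} → Linked R xs → head xs ≡ just a → 2 ≤ length xs →
                  ∃ λ c → c ∈ xs × R a c
  Linked⇒second {xs = x ∷ []}     _       _    (s≤s ())
  Linked⇒second {xs = x ∷ y ∷ xs} (r ∷ _) refl _ = y , there (here refl) , r

  Linked⇒penultimate : ∀ {R : A → A → Set} {xs : List A} {b} → Linked R xs → last xs ≡ just b → 2 ≤ length xs →
                       ∃ λ d → d ∈ xs × R d b
  Linked⇒penultimate {xs = x ∷ []}         _        _    (s≤s ())
  Linked⇒penultimate {xs = x ∷ y ∷ []}     (r ∷ _)  refl _ = x , here refl , r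
  Linked⇒penultimate {xs = x ∷ y ∷ z ∷ xs} (_ ∷ rs) eq   _
    with d , d∈ , r ← Linked⇒penultimate {xs = y ∷ z ∷ xs} rs eq (s≤s (s≤s z≤n)) = d , there d∈ , r

  length-concat-replicate : ∀ s (xs : List A) → length (concat (replicate s xs)) ≡ s * length xs
  length-concat-replicate zero    xs = refl
  length-concat-replicate (suc s) xs = trans (length-++ xs) (cong (length xs +_) (length-concat-replicate s xs))

  Pointwise-concat-replicate⁻ : ∀ {B : Set} {R : A → B → Set} s xs {ys} → Pointwise R (concat (replicate s xs)) ys →
                                ∃ λ yss → ys ≡ concat yss × length yss ≡ s × All (Pointwise R xs) yss
  Pointwise-concat-replicate⁻ zero    xs []  = [] , refl , refl , []
  Pointwise-concat-replicate⁻ (suc s) xs rs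
    with ys , ys′ , refl , r , rs′ ← Pointwise-++⁻ xs rs
    with yss , refl , refl , all ← Pointwise-concat-replicate⁻ s xs rs′
    = ys ∷ yss , refl , refl , r ∷ all

  length-concat∘concat : ∀ (xsss : List (List (List A))) → length (concat (concat xsss)) ≡ sum (map (length ∘ concat) xsss)
  length-concat∘concat []           = refl
  length-concat∘concat (xss ∷ xsss) = begin
    length (concat (concat (xss ∷ xsss)))               ≡⟨ cong length (concat-++ xss (concat xsss)) ⟨
    length (concat xss ++ concat (concat xsss))         ≡⟨ length-++ (concat xss) ⟩
    length (concat xss) + length (concat (concat xsss)) ≡⟨ cong (length (concat xss) +_) (length-concat∘concat xsss) ⟩
    sum (map (length ∘ concat) (xss ∷ xsss))            ∎
    where open ≡-Reasoning

  ∃-below-average : ∀ {P : A → Set} (f : A → ℕ) ws → All P ws → 1 ≤ length ws →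
                    ∃ λ w → P w × length ws * f w ≤ sum (map f ws)
  ∃-below-average f (w ∷ [])      (pw ∷ [])  _ = w , pw , ≤-refl
  ∃-below-average f (w ∷ w′ ∷ ws) (pw ∷ pws) _
    with v , pv , v-cheap ← ∃-below-average f (w′ ∷ ws) pws (s≤s z≤n)
    with f w ≤? f v
  ... | yes fw≤fv = w , pw , +-monoʳ-≤ (f w) (≤-trans (*-monoʳ-≤ (length (w′ ∷ ws)) fw≤fv) v-cheap)
  ... | no  fw≰fv = v , pv , +-mono-≤ (<⇒≤ (≰⇒> fw≰fv)) v-cheap

  last≡lastOr : ∀ (d : A) xs {a} → head xs ≡ just a → last xs ≡ just (fromMaybe d (last xs))
  last≡lastOr d (x ∷ [])     _ = refl
  last≡lastOr d (x ∷ y ∷ xs) _ = last≡lastOr d (y ∷ xs) refl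

  head≡headOr : ∀ (d : A) xs {a} → head xs ≡ just a → head xs ≡ just (fromMaybe d (head xs))
  head≡headOr d (x ∷ xs) _ = refl

  head-++⇒∈ : ∀ (xs : List A) {ys a v} → head xs ≡ just a → head (xs ++ ys) ≡ just v → v ∈ xs
  head-++⇒∈ (x ∷ xs) _ refl = here refl

  EdgeOf⇒∈ : ∀ {u v : A} {xs} → EdgeOf u v xs → u ∈ xs × v ∈ xs
  EdgeOf⇒∈ here      = here refl , there (here refl)
  EdgeOf⇒∈ (there e) with EdgeOf⇒∈ e
  ... | u∈ , v∈ = there u∈ , there v∈

  EdgeOf-++⁺ˡ : ∀ {u v : A} xs {ys} → EdgeOf u v xs → EdgeOf u v (xs ++ ys)
  EdgeOf-++⁺ˡ (x ∷ y ∷ xs) here      = here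
  EdgeOf-++⁺ˡ (x ∷ xs)     (there e) = there (EdgeOf-++⁺ˡ xs e)

  EdgeOf-++⁺ʳ : ∀ {u v : A} xs {ys} → EdgeOf u v ys → EdgeOf u v (xs ++ ys)
  EdgeOf-++⁺ʳ []       e = e
  EdgeOf-++⁺ʳ (x ∷ xs) e = there (EdgeOf-++⁺ʳ xs e)

  EdgeOf-++⁻ : ∀ {u v : A} xs {ys} → EdgeOf u v (xs ++ ys) →
               EdgeOf u v xs ⊎ EdgeOf u v ys ⊎ (u ∈ xs × head ys ≡ just v)
  EdgeOf-++⁻ []           e = inj₂ (inj₁ e)
  EdgeOf-++⁻ (x ∷ [])     {y ∷ ys} here = inj₂ (inj₂ (here refl , refl))
  EdgeOf-++⁻ (x ∷ x′ ∷ xs) here = inj₁ here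
  EdgeOf-++⁻ (x ∷ xs) (there e) with EdgeOf-++⁻ xs e
  ... | inj₁ e′              = inj₁ (there e′)
  ... | inj₂ (inj₁ e′)       = inj₂ (inj₁ e′)
  ... | inj₂ (inj₂ (u∈ , h)) = inj₂ (inj₂ (there u∈ , h))

concatMap-allFin-suc : ∀ {A : Set} {k} (f : Fin (suc k) → List A) →
                       concatMap f (allFin (suc k)) ≡ f zero ++ concatMap (f ∘ suc) (allFin k)
concatMap-allFin-suc {k = k} f = cong (λ xss → f zero ++ concat xss)
  (trans (map-tabulate suc f) (sym (map-tabulate id (f ∘ suc))))

module _ {A : Set} where

  ∈-concatMap-allFin⁺ : ∀ {k} (f : Fin k → List A) i {v} → v ∈ f i → v ∈ concatMap f (allFin k)
  ∈-concatMap-allFin⁺ f i v∈ = ∈-concat⁺′ v∈ (∈-map⁺ f (∈-allFin i))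

  ∈-concatMap-allFin⁻ : ∀ {k} (f : Fin k → List A) {v} → v ∈ concatMap f (allFin k) → ∃ λ i → v ∈ f i
  ∈-concatMap-allFin⁻ {k} f v∈ with xs , v∈xs , xs∈ ← ∈-concat⁻′ (map f (allFin k)) v∈ with ∈-map⁻ f xs∈
  ... | i , _ , refl = i , v∈xs

  Unique-concatMap-allFin⁻ : ∀ k (f : Fin k → List A) → Unique (concatMap f (allFin k)) →
                             (∀ i → Unique (f i)) × (∀ i j {v} → v ∈ f i → v ∈ f j → i ≡ j)
  Unique-concatMap-allFin⁻ zero    f u = (λ ()) , λ ()
  Unique-concatMap-allFin⁻ (suc k) f u
    with u₀ , u₊ , disj ← Unique-++⁻ (f zero) (subst Unique (concatMap-allFin-suc f) u)
    with us , same ← Unique-concatMap-allFin⁻ k (f ∘ suc) u₊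
    = (λ { zero → u₀ ; (suc i) → us i }) , λ
      { zero    zero    _  _  → refl
      ; zero    (suc j) v∈ v∈′ → ⊥-elim (disj (v∈ , ∈-concatMap-allFin⁺ (f ∘ suc) j v∈′))
      ; (suc i) zero    v∈ v∈′ → ⊥-elim (disj (v∈′ , ∈-concatMap-allFin⁺ (f ∘ suc) i v∈))
      ; (suc i) (suc j) v∈ v∈′ → cong suc (same i j v∈ v∈′) }

  Pointwise-concatMap-allFin⁻ : ∀ {B : Set} {R : A → B → Set} k (f : Fin k → List A) {ys} →
                                Pointwise R (concatMap f (allFin k)) ys →
                                ∃ λ (g : Fin k → List B) → (∀ i → Pointwise R (f i) (g i)) × ys ≡ concatMap g (allFin k)
  Pointwise-concatMap-allFin⁻ zero    f []  = (λ ()) , (λ ()) , refl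
  Pointwise-concatMap-allFin⁻ (suc k) f {ys} rs
    with ys₀ , ys₊ , refl , r₀ , r₊ ← Pointwise-++⁻ (f zero) (subst (λ zs → Pointwise _ zs ys) (concatMap-allFin-suc f) rs)
    with g , rg , refl ← Pointwise-concatMap-allFin⁻ k (f ∘ suc) r₊
    = g′ , (λ { zero → r₀ ; (suc i) → rg i }) , sym (concatMap-allFin-suc g′)
    where
    g′ : Fin (suc k) → List _
    g′ zero    = ys₀
    g′ (suc i) = g i

  concat∘concatMap : ∀ {I : Set} (f : I → List (List A)) is → concat (concatMap f is) ≡ concatMap (concat ∘ f) is
  concat∘concatMap f []       = refl
  concat∘concatMap f (i ∷ is) = trans (sym (concat-++ (f i) (concatMap f is))) (cong (concat (f i) ++_) (concat∘concatMap f is))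

module _ where
  open +-*-Solver

  2+m≤m+2*[1+n] : ∀ m n → 2 + m ≤ m + 2 * suc n
  2+m≤m+2*[1+n] m n = ≤-trans (≤-reflexive (+-comm 2 m)) (+-monoʳ-≤ m (*-monoʳ-≤ 2 (s≤s z≤n)))

  slack-bounds : ∀ {e r c L d} → e ≡ 2 * L → e + r ≤ 2 * (L + d) → 2 * (L + d) ≤ e + c → r ≤ 2 * d × 2 * d ≤ c
  slack-bounds {e} {r} {c} {L} {d} refl e+r≤ ≤e+c =
    +-cancelˡ-≤ e r (2 * d) (≤-trans e+r≤ (≤-reflexive (*-distribˡ-+ 2 L d))) ,
    +-cancelˡ-≤ e (2 * d) c (≤-trans (≤-reflexive (sym (*-distribˡ-+ 2 L d))) ≤e+c)

  m≤s*m : ∀ s m → 1 ≤ s → m ≤ s * m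
  m≤s*m s m 1≤s = ≤-trans (≤-reflexive (sym (*-identityˡ m))) (*-monoˡ-≤ m 1≤s)

  size-for-bridges : ∀ s k g w → 1 ≤ s → k ≤ g → w + (k + k) + 2 * (s * g) ≤ 2 * (2 * s * (g + w))
  size-for-bridges s k g w 1≤s k≤g = begin
    w + (k + k) + 2 * (s * g)                           ≤⟨ +-monoˡ-≤ (2 * (s * g)) (+-mono-≤ (m≤s*m s w 1≤s) (+-mono-≤ k≤sg k≤sg)) ⟩
    s * w + (s * g + s * g) + 2 * (s * g)               ≤⟨ m≤m+n _ (3 * (s * w)) ⟩
    s * w + (s * g + s * g) + 2 * (s * g) + 3 * (s * w) ≡⟨ solve 3 (λ s g w → w′ s g w := con 2 :* (con 2 :* s :* (g :+ w))) refl s g w ⟩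
    2 * (2 * s * (g + w))                               ∎
    where
    open ≤-Reasoning
    k≤sg = ≤-trans k≤g (m≤s*m s g 1≤s)
    w′ = λ s g w → s :* w :+ (s :* g :+ s :* g) :+ con 2 :* (s :* g) :+ con 3 :* (s :* w)

  size-of-union : ∀ s k g w c D N → k ≤ g → D ≤ w + (k + k + c) →
                  s * c + 2 * (2 * s * (g + w)) ≤ N + 2 * (s * g) → s * D ≤ N + s * w
  size-of-union s k g w c D N k≤g D≤ bound = begin
    s * D                         ≤⟨ *-monoʳ-≤ s D≤ ⟩
    s * (w + (k + k + c))         ≡⟨ solve 4 (λ s w k c → s :* (w :+ (k :+ k :+ c)) := s :* w :+ (s :* (k :+ k) :+ s :* c)) refl s w k c ⟩
    s * w + (s * (k + k) + s * c) ≤⟨ +-monoʳ-≤ (s * w) (≤-trans (+-monoˡ-≤ (s * c) 2sk≤2sg) 2sg+sc≤N) ⟩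
    s * w + N                     ≡⟨ +-comm (s * w) N ⟩
    N + s * w                     ∎
    where
    open ≤-Reasoning
    2sk≤2sg : s * (k + k) ≤ 2 * (s * g)
    2sk≤2sg = ≤-trans (*-monoʳ-≤ s (+-mono-≤ k≤g k≤g)) (≤-reflexive (solve 2 (λ s g → s :* (g :+ g) := con 2 :* (s :* g)) refl s g))
    2sg+sc≤N : 2 * (s * g) + s * c ≤ N
    2sg+sc≤N = +-cancelʳ-≤ (2 * (s * g)) _ _ (begin
      2 * (s * g) + s * c + 2 * (s * g)                 ≤⟨ m≤m+n _ (4 * (s * w)) ⟩
      2 * (s * g) + s * c + 2 * (s * g) + 4 * (s * w)   ≡⟨ solve 4 (λ s g w c → con 2 :* (s :* g) :+ s :* c :+ con 2 :* (s :* g) :+ con 4 :* (s :* w)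
                                                                  := s :* c :+ con 2 :* (con 2 :* s :* (g :+ w))) refl s g w c ⟩
      s * c + 2 * (2 * s * (g + w))                     ≤⟨ bound ⟩
      N + 2 * (s * g)                                   ∎)

-- Counting distinct elements

module _ {A : Set} (_≟_ : DecidableEquality A) where

  Unique∧⊆⇒length≤ : ∀ {xs ys : List A} → Unique xs → xs ⊆ ys → length xs ≤ length ys
  Unique∧⊆⇒length≤ {[]}     _             _     = z≤n
  Unique∧⊆⇒length≤ {x ∷ xs} {ys} (x∉xs ∷ uxs) xs⊆ys =
    ≤-trans (s≤s (Unique∧⊆⇒length≤ uxs xs⊆ys-x)) (filter-notAll (¬? ∘ (x ≟_)) ys (lose (xs⊆ys (here refl)) λ x≢x → x≢x refl))
    where
    xs⊆ys-x : xs ⊆ filter (¬? ∘ (x ≟_)) ys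
    xs⊆ys-x v∈ = ∈-filter⁺ (¬? ∘ (x ≟_)) (xs⊆ys (there v∈)) (All.lookup x∉xs v∈)

  open import Data.List.Membership.DecPropositional _≟_ using (_∈?_)

  _∖_ : List A → List A → List A
  xs ∖ ys = filter (¬? ∘ (_∈? ys)) xs

  ∈-∖⁺ : ∀ {xs ys v} → v ∈ xs → v ∉ ys → v ∈ xs ∖ ys
  ∈-∖⁺ {ys = ys} = ∈-filter⁺ (¬? ∘ (_∈? ys))

  ∈-∖⁻ : ∀ xs {ys v} → v ∈ xs ∖ ys → v ∈ xs × v ∉ ys
  ∈-∖⁻ xs {ys} = ∈-filter⁻ (¬? ∘ (_∈? ys)) {xs = xs}

  Unique-∖ : ∀ {xs} ys → Unique xs → Unique (xs ∖ ys)
  Unique-∖ ys = Uniqueₚ.filter⁺ (¬? ∘ (_∈? ys))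

  ∈-++-∖ : ∀ xs {ys v} → v ∈ ys → v ∈ xs ++ (ys ∖ xs)
  ∈-++-∖ xs {v = v} v∈ys with v ∈? xs
  ... | yes v∈xs = ∈-++⁺ˡ v∈xs
  ... | no  v∉xs = ∈-++⁺ʳ xs (∈-∖⁺ v∈ys v∉xs)

module _ {m : ℕ} where
  private
    V = Fin m
  open import Data.List.Relation.Unary.Unique.DecPropositional.Properties (_≟_ {m}) using (deduplicate-!)
  open import Data.List.Membership.DecPropositional (_≟_ {m}) using (_∈?_)

  length-allFin : length (allFin m) ≡ m
  length-allFin = length-tabulate id

  ∣∣ᵈ-mono : ∀ {xs ys : List V} → xs ⊆ ys → ∣ xs ∣ᵈ ≤ ∣ ys ∣ᵈ
  ∣∣ᵈ-mono {xs} xs⊆ys = Unique∧⊆⇒length≤ _≟_ (deduplicate-! xs)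
    (∈-deduplicate⁺ _≟_ ∘ xs⊆ys ∘ ∈-deduplicate⁻ _≟_ xs)

  ∣∷∣ᵈ≤ : ∀ (x : V) xs → ∣ x ∷ xs ∣ᵈ ≤ suc ∣ xs ∣ᵈ
  ∣∷∣ᵈ≤ x xs = s≤s (length-filter (¬? ∘ (x ≟_)) (deduplicate _≟_ xs))

  ∣++∣ᵈ≤ : ∀ (xs ys : List V) → ∣ xs ++ ys ∣ᵈ ≤ ∣ xs ∣ᵈ + length ys
  ∣++∣ᵈ≤ xs ys = ≤-trans (Unique∧⊆⇒length≤ _≟_ (deduplicate-! (xs ++ ys)) ⊆dedup++) (≤-reflexive (length-++ (deduplicate _≟_ xs)))
    where
    ⊆dedup++ : deduplicate _≟_ (xs ++ ys) ⊆ deduplicate _≟_ xs ++ ys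
    ⊆dedup++ v∈ with ∈-++⁻ xs (∈-deduplicate⁻ _≟_ (xs ++ ys) v∈)
    ... | inj₁ v∈xs = ∈-++⁺ˡ (∈-deduplicate⁺ _≟_ v∈xs)
    ... | inj₂ v∈ys = ∈-++⁺ʳ _ v∈ys

  Unique⇒length≤∣++∣ᵈ : ∀ {xs : List V} ys → Unique xs → length xs ≤ ∣ xs ++ ys ∣ᵈ
  Unique⇒length≤∣++∣ᵈ ys u = Unique∧⊆⇒length≤ _≟_ u (∈-deduplicate⁺ _≟_ ∘ ∈-++⁺ˡ)

  Unique⇒length≤ : ∀ {xs : List V} → Unique xs → length xs ≤ m
  Unique⇒length≤ u = ≤-trans (Unique∧⊆⇒length≤ _≟_ u (λ {v} _ → ∈-allFin v)) (≤-reflexive length-allFin)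

  covering⇒length≥ : ∀ {ys : List V} → (∀ v → v ∈ ys) → m ≤ length ys
  covering⇒length≥ all∈ = ≤-trans (≤-reflexive (sym length-allFin)) (Unique∧⊆⇒length≤ _≟_ (Uniqueₚ.allFin⁺ m) (λ {v} _ → all∈ v))

  ∃∉ : ∀ (F : List V) → ∣ F ∣ᵈ < m → ∃ λ v → v ∉ F
  ∃∉ F ∣F∣<m = ¬∀⟶∃¬ m (_∈ F) (_∈? F) λ all∈ →
    <⇒≱ ∣F∣<m (covering⇒length≥ (λ v → ∈-deduplicate⁺ _≟_ (all∈ v)))

  ∣x∷y∷F∣ᵈ+2*n≤ : ∀ (x y : V) F r → ∣ x ∷ y ∷ F ∣ᵈ + 2 * r ≤ ∣ F ∣ᵈ + 2 * suc r
  ∣x∷y∷F∣ᵈ+2*n≤ x y F r = ≤-trans (+-monoˡ-≤ (2 * r) (≤-trans (∣∷∣ᵈ≤ x (y ∷ F)) (s≤s (∣∷∣ᵈ≤ y F))))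
    (≤-reflexive (solve 2 (λ f r → (con 2 :+ f) :+ con 2 :* r := f :+ con 2 :* (con 1 :+ r)) refl ∣ F ∣ᵈ r))
    where open +-*-Solver

  -- The vertices outside ends, listed so that those of F come first.
  padding-pool : ∀ (ends F : List V) → Unique ends →
                 ∃₂ λ R C → Unique (ends ++ R ++ C) × m ≤ length ends + length (R ++ C)
                          × length ends + length R ≤ ∣ ends ++ F ∣ᵈ × (∀ {v} → v ∈ F → v ∉ ends → v ∈ R)
  padding-pool ends F u-ends = R , C , u-ends-R-C , complete , small , λ v∈F → ∈-∖⁺ _≟_ (∈-deduplicate⁺ _≟_ v∈F)
    where
    R = _∖_ _≟_ (deduplicate _≟_ F) ends
    C = _∖_ _≟_ (allFin m) (ends ++ R)

    u-ends-R : Unique (ends ++ R)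
    u-ends-R = Uniqueₚ.++⁺ u-ends (Unique-∖ _≟_ ends (deduplicate-! F))
      λ (v∈ends , v∈R) → proj₂ (∈-∖⁻ _≟_ (deduplicate _≟_ F) v∈R) v∈ends

    u-ends-R-C : Unique (ends ++ R ++ C)
    u-ends-R-C = subst Unique (++-assoc ends R C) (Uniqueₚ.++⁺ u-ends-R (Unique-∖ _≟_ (ends ++ R) (Uniqueₚ.allFin⁺ m))
      λ (v∈ends++R , v∈C) → proj₂ (∈-∖⁻ _≟_ (allFin m) v∈C) v∈ends++R)

    complete : m ≤ length ends + length (R ++ C)
    complete = begin
      m                               ≤⟨ covering⇒length≥ (λ v → ∈-++-∖ _≟_ (ends ++ R) (∈-allFin v)) ⟩
      length ((ends ++ R) ++ C)       ≡⟨ cong length (++-assoc ends R C) ⟩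
      length (ends ++ R ++ C)         ≡⟨ length-++ ends ⟩
      length ends + length (R ++ C)   ∎
      where open ≤-Reasoning

    small : length ends + length R ≤ ∣ ends ++ F ∣ᵈ
    small = ≤-trans (≤-reflexive (sym (length-++ ends))) (Unique∧⊆⇒length≤ _≟_ u-ends-R ends++R⊆)
      where
      ends++R⊆ : ends ++ R ⊆ deduplicate _≟_ (ends ++ F)
      ends++R⊆ v∈ with ∈-++⁻ ends v∈
      ... | inj₁ v∈ends = ∈-deduplicate⁺ _≟_ (∈-++⁺ˡ v∈ends)
      ... | inj₂ v∈R    = ∈-deduplicate⁺ _≟_ (∈-++⁺ʳ ends (∈-deduplicate⁻ _≟_ F (proj₁ (∈-∖⁻ _≟_ (deduplicate _≟_ F) v∈R))))

  extend-pairs : ∀ d (ps : List (V × V)) (F : List V) → Unique (endpoints ps) →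
                 ∣ endpoints ps ++ F ∣ᵈ ≤ 2 * (length ps + d) → 2 * (length ps + d) ≤ m →
                 ∃ λ qs → length qs ≡ d × Unique (endpoints ps ++ endpoints qs) ×
                          (∀ {v} → v ∈ F → v ∉ endpoints ps → v ∈ endpoints qs)
  extend-pairs d ps F u-ends size 2M≤m
    with R , C , u , complete , small , F⊆R ← padding-pool (endpoints ps) F u-ends
    with R≤2d , 2d≤R++C ← slack-bounds {L = length ps} {d = d} (length-endpoints ps) (≤-trans small size) (≤-trans 2M≤m complete)
    with length-qs , rest , qs++rest≡ ← pairUp-endpoints d (R ++ C) 2d≤R++C
    = pairUp d (R ++ C) , length-qs , u-ends-qs , F⊆qs
    where
    qs = pairUp d (R ++ C)

    F⊆qs : ∀ {v} → v ∈ F → v ∉ endpoints ps → v ∈ endpoints qs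
    F⊆qs v∈F v∉ends = ⊆-shorter-prefix R (sym qs++rest≡)
      (≤-trans R≤2d (≤-reflexive (sym (trans (length-endpoints qs) (cong (2 *_) length-qs)))))
      (F⊆R v∈F v∉ends)

    u-ends-qs : Unique (endpoints ps ++ endpoints qs)
    u-ends-qs with u-ends , u-R++C , disj ← Unique-++⁻ (endpoints ps) u
              with u-qs , _ , _ ← Unique-++⁻ (endpoints qs) (subst Unique (sym qs++rest≡) u-R++C)
      = Uniqueₚ.++⁺ u-ends u-qs λ (v∈ends , v∈qs) → disj (v∈ends , subst (_ ∈_) qs++rest≡ (∈-++⁺ˡ v∈qs))

-- Linkages avoiding a set of vertices

module _ (T : Digraph) where
  private
    V = Fin (n T)
  open import Data.List.Membership.DecPropositional (_≟_ {n T}) using (_∈?_)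

  Connects : V × V → List V → Set
  Connects (a , b) = PathFrom T a b

  Connects⇒∈ : ∀ {a b σ} → Connects (a , b) σ → a ∈ σ × b ∈ σ
  Connects⇒∈ (_ , h , l) = head⇒∈ h , last⇒∈ l

  Connects⇒2≤length : ∀ {a b σ} → Connects (a , b) σ → a ≢ b → 2 ≤ length σ
  Connects⇒2≤length {σ = x ∷ []}    (_ , refl , refl) a≢b = contradiction refl a≢b
  Connects⇒2≤length {σ = x ∷ y ∷ σ} _                 _   = s≤s (s≤s z≤n)

  connected-Unique : ∀ {ps σs} → Pointwise Connects ps σs → All Unique σs
  connected-Unique []                      = []
  connected-Unique (((_ , u , _) , _) ∷ cs) = u ∷ connected-Unique cs

  endpoints⊆V : ∀ {ps σs} → Pointwise Connects ps σs → ∀ {v} → v ∈ endpoints ps → v ∈V σs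
  endpoints⊆V (c ∷ cs) (here refl)         = here (proj₁ (Connects⇒∈ c))
  endpoints⊆V (c ∷ cs) (there (here refl)) = here (proj₂ (Connects⇒∈ c))
  endpoints⊆V (c ∷ cs) (there (there v∈))  = there (endpoints⊆V cs v∈)

  2*length≤length-concat : ∀ {ps σs} → Pointwise Connects ps σs → Unique (endpoints ps) →
                           2 * length ps ≤ length (concat σs)
  2*length≤length-concat {[]}     []       _ = z≤n
  2*length≤length-concat {p ∷ ps} {σ ∷ σs} (c ∷ cs) ((a≢b ∷ _) ∷ _ ∷ u) = begin
    2 * suc (length ps)                    ≡⟨ *-distribˡ-+ 2 1 (length ps) ⟩
    2 + 2 * length ps                      ≤⟨ +-mono-≤ (Connects⇒2≤length c a≢b) (2*length≤length-concat cs u) ⟩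
    length σ + length (concat σs)          ≡⟨ length-++ σ ⟨
    length (concat (σ ∷ σs))               ∎
    where open ≤-Reasoning

  link-pairs : ∀ (ps : List (V × V)) → Linked' T (length ps) → Unique (endpoints ps) →
               ∃ λ σs → Pointwise Connects ps σs × AllPairs VDisjoint σs
  link-pairs ps (_ , link) u
    with σ , connects , disjoint ← link (proj₁ ∘ lookup ps) (proj₂ ∘ lookup ps)
                                       (sources-injective ps u) (targets-injective ps u) (source≢target ps u)
    = tabulate σ
    , subst (λ qs → Pointwise Connects qs (tabulate σ)) (tabulate-lookup ps) (Pointwise.tabulate⁺ connects)
    , AllPairsₚ.tabulate⁺ (disjoint _ _)

  record Linkage (M : ℕ) (ps : List (V × V)) (F : List V) : Set where
    field
      paths    : List (List V)
      connects : Pointwise Connects ps paths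
      disjoint : AllPairs VDisjoint paths
      avoids   : ∀ {σ v} → σ ∈ paths → v ∈ σ → v ∈ F → v ∈ endpoints ps
      short    : length (concat paths) + 2 * M ≤ n T + 2 * length ps

  drop-padding : ∀ ps qs F {σs} → Unique (endpoints qs) → (∀ {v} → v ∈ F → v ∉ endpoints ps → v ∈ endpoints qs) →
                 Pointwise Connects (ps ++ qs) σs → AllPairs VDisjoint σs → Linkage (length ps + length qs) ps F
  drop-padding ps qs F u-qs F⊆qs cs ds
    with σs , τs , refl , cs₁ , cs₂ ← Pointwise-++⁻ ps cs
    with ds₁ , _ , cross ← AllPairs-++⁻ σs ds
    = record { paths = σs ; connects = cs₁ ; disjoint = ds₁ ; avoids = avoids ; short = short }
    where
    avoids : ∀ {σ v} → σ ∈ σs → v ∈ σ → v ∈ F → v ∈ endpoints ps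
    avoids {σ} {v} σ∈ v∈σ v∈F with v ∈? endpoints ps
    ... | yes v∈ps = v∈ps
    ... | no  v∉ps with τ , τ∈ , v∈τ ← find (endpoints⊆V cs₂ (F⊆qs v∈F v∉ps))
      = contradiction v∈τ (cross σ∈ τ∈ v v∈σ)

    c = length (concat σs)
    L = length ps
    d = length qs

    c+τ≤n : c + length (concat τs) ≤ n T
    c+τ≤n = begin
      c + length (concat τs)          ≡⟨ length-++ (concat σs) ⟨
      length (concat σs ++ concat τs) ≡⟨ cong length (concat-++ σs τs) ⟩
      length (concat (σs ++ τs))      ≤⟨ Unique⇒length≤ (Unique-concat⁺ (connected-Unique cs) ds) ⟩
      n T                             ∎
      where open ≤-Reasoning

    short : c + 2 * (L + d) ≤ n T + 2 * L
    short = begin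
      c + 2 * (L + d)         ≡⟨ cong (c +_) (*-distribˡ-+ 2 L d) ⟩
      c + (2 * L + 2 * d)     ≡⟨ cong (c +_) (+-comm (2 * L) (2 * d)) ⟩
      c + (2 * d + 2 * L)     ≡⟨ +-assoc c (2 * d) (2 * L) ⟨
      c + 2 * d + 2 * L       ≤⟨ +-monoˡ-≤ (2 * L) (≤-trans (+-monoʳ-≤ c (2*length≤length-concat cs₂ u-qs)) c+τ≤n) ⟩
      n T + 2 * L             ∎
      where open ≤-Reasoning

  -- ps is padded, with pairs drawn first from F, to exactly M pairs, which are then linked: F is
  -- met only at terminals, and the padding paths, of at least two vertices each, give the bound.
  link-avoiding : ∀ M → Linked' T M → ∀ ps F → Unique (endpoints ps) → ∣ endpoints ps ++ F ∣ᵈ ≤ 2 * M →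
                  Linkage M ps F
  link-avoiding M linked ps F u size
    with d , refl ← m≤n⇒∃[o]m+o≡n {length ps} {M} (*-cancelˡ-≤ 2 (≤-trans (≤-reflexive (sym (length-endpoints ps)))
                                                          (≤-trans (Unique⇒length≤∣++∣ᵈ F u) size)))
    with qs , refl , u-ps++qs , F⊆qs ← extend-pairs d ps F u size (proj₁ linked)
    with σs , cs , ds ← link-pairs (ps ++ qs) (subst (Linked' T) (sym (length-++ ps)) linked)
                                   (subst Unique (sym (endpoints-++ ps qs)) u-ps++qs)
    = drop-padding ps qs F (proj₁ (proj₂ (Unique-++⁻ (endpoints ps) u-ps++qs))) F⊆qs cs ds

  linkage⇒neighbours : ∀ {M a b z₁ z₂ F} → z₁ ∉ F → z₂ ∉ F → a ≢ z₁ → z₂ ≢ b →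
                       Linkage M ((a , z₁) ∷ (z₂ , b) ∷ []) F →
                       ∃₂ λ c d → E T a c × E T d b × c ∉ F × d ∉ F × c ≢ d
  linkage⇒neighbours {a = a} {b} {F = F} z₁∉F z₂∉F a≢z₁ z₂≢b
    record { paths = σ₁ ∷ σ₂ ∷ [] ; connects = c₁ ∷ c₂ ∷ [] ; disjoint = (σ₁∩σ₂ ∷ []) ∷ _ ; avoids = avoids }
    with c , c∈σ₁ , ac ← Linked⇒second (proj₁ (proj₁ c₁)) (proj₁ (proj₂ c₁)) (Connects⇒2≤length c₁ a≢z₁)
    with d , d∈σ₂ , db ← Linked⇒penultimate (proj₁ (proj₁ c₂)) (proj₂ (proj₂ c₂)) (Connects⇒2≤length c₂ z₂≢b)
    = c , d , ac , db , c∉F , d∉F , λ c≡d → σ₁∩σ₂ c c∈σ₁ (subst (_∈ σ₂) (sym c≡d) d∈σ₂)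
    where
    c∉F : c ∉ F
    c∉F c∈F with avoids (here refl) c∈σ₁ c∈F
    ... | here c≡a                         = loopless T a (subst (E T a) c≡a ac)
    ... | there (here c≡z₁)                = z₁∉F (subst (_∈ F) c≡z₁ c∈F)
    ... | there (there (here c≡z₂))        = σ₁∩σ₂ c c∈σ₁ (subst (_∈ σ₂) (sym c≡z₂) (proj₁ (Connects⇒∈ c₂)))
    ... | there (there (there (here c≡b))) = σ₁∩σ₂ c c∈σ₁ (subst (_∈ σ₂) (sym c≡b) (proj₂ (Connects⇒∈ c₂)))

    d∉F : d ∉ F
    d∉F d∈F with avoids (there (here refl)) d∈σ₂ d∈F
    ... | here d≡a                         = σ₁∩σ₂ d (subst (_∈ σ₁) (sym d≡a) (proj₁ (Connects⇒∈ c₁))) d∈σ₂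
    ... | there (here d≡z₁)                = σ₁∩σ₂ d (subst (_∈ σ₁) (sym d≡z₁) (proj₂ (Connects⇒∈ c₁))) d∈σ₂
    ... | there (there (here d≡z₂))        = z₂∉F (subst (_∈ F) d≡z₂ d∈F)
    ... | there (there (there (here d≡b))) = loopless T b (subst (λ v → E T v b) d≡b db)

  fresh-neighbours : ∀ M → Linked' T M → ∀ {a b} F → a ∈ F → b ∈ F → a ≢ b → 2 + ∣ F ∣ᵈ ≤ 2 * M →
                     ∃₂ λ c d → E T a c × E T d b × c ∉ F × d ∉ F × c ≢ d
  fresh-neighbours M linked {a} {b} F a∈F b∈F a≢b size
    with z₁ , z₁∉F   ← ∃∉ F (≤-trans (n≤1+n _) (≤-trans size (proj₁ linked)))
    with z₂ , z₂∉z₁F ← ∃∉ (z₁ ∷ F) (≤-trans (s≤s (∣∷∣ᵈ≤ z₁ F)) (≤-trans size (proj₁ linked)))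
    = linkage⇒neighbours z₁∉F z₂∉F a≢z₁ z₂≢b (link-avoiding M linked ((a , z₁) ∷ (z₂ , b) ∷ []) F u size′)
    where
    z₂∉F : z₂ ∉ F
    z₂∉F = z₂∉z₁F ∘ there
    a≢z₁ = ∈∧∉⇒≢ a∈F z₁∉F
    z₂≢b = λ z₂≡b → ∈∧∉⇒≢ b∈F z₂∉F (sym z₂≡b)

    u : Unique (a ∷ z₁ ∷ z₂ ∷ b ∷ [])
    u = (a≢z₁ ∷ ∈∧∉⇒≢ a∈F z₂∉F ∷ a≢b ∷ [])
      ∷ ((λ z₁≡z₂ → z₂∉z₁F (here (sym z₁≡z₂))) ∷ (λ z₁≡b → ∈∧∉⇒≢ b∈F z₁∉F (sym z₁≡b)) ∷ [])
      ∷ (z₂≢b ∷ [])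
      ∷ [] ∷ []

    size′ : ∣ (a ∷ z₁ ∷ z₂ ∷ b ∷ []) ++ F ∣ᵈ ≤ 2 * M
    size′ = begin
      ∣ a ∷ z₁ ∷ z₂ ∷ b ∷ F ∣ᵈ ≤⟨ ∣∣ᵈ-mono ⊆z₁z₂F ⟩
      ∣ z₁ ∷ z₂ ∷ F ∣ᵈ         ≤⟨ ∣∷∣ᵈ≤ z₁ (z₂ ∷ F) ⟩
      suc ∣ z₂ ∷ F ∣ᵈ          ≤⟨ s≤s (∣∷∣ᵈ≤ z₂ F) ⟩
      2 + ∣ F ∣ᵈ               ≤⟨ size ⟩
      2 * M                    ∎
      where
      open ≤-Reasoning
      ⊆z₁z₂F : a ∷ z₁ ∷ z₂ ∷ b ∷ F ⊆ z₁ ∷ z₂ ∷ F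
      ⊆z₁z₂F (here refl)                         = there (there a∈F)
      ⊆z₁z₂F (there (here refl))                 = here refl
      ⊆z₁z₂F (there (there (here refl)))         = there (here refl)
      ⊆z₁z₂F (there (there (there (here refl)))) = there (there b∈F)
      ⊆z₁z₂F (there (there (there (there v∈F)))) = there (there v∈F)

  -- Bridges

  Request : List V → V × V → Set
  Request F (a , b) = a ∈ F × b ∈ F × a ≢ b

  ProxyOf : V × V → V × V → Set
  ProxyOf (a , b) (c , d) = E T a c × E T d b

  Request-∷ : ∀ {F r} x → Request F r → Request (x ∷ F) r
  Request-∷ x (a∈ , b∈ , a≢b) = there a∈ , there b∈ , a≢b

  choose-proxies : ∀ M → Linked' T M → ∀ F rs → All (Request F) rs → ∣ F ∣ᵈ + 2 * length rs ≤ 2 * M →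
                   ∃ λ ps → Pointwise ProxyOf rs ps × Unique (endpoints ps) × (∀ {v} → v ∈ endpoints ps → v ∉ F)
  choose-proxies M linked F []             []                       _    = [] , [] , [] , λ ()
  choose-proxies M linked F ((a , b) ∷ rs) ((a∈ , b∈ , a≢b) ∷ reqs) size =
    let c , d , ac , db , c∉F , d∉F , c≢d =
          fresh-neighbours M linked F a∈ b∈ a≢b (≤-trans (2+m≤m+2*[1+n] ∣ F ∣ᵈ (length rs)) size)
        ps , proxies , u , avoid =
          choose-proxies M linked (c ∷ d ∷ F) rs (All.map (Request-∷ c ∘ Request-∷ d) reqs)
                         (≤-trans (∣x∷y∷F∣ᵈ+2*n≤ c d F (length rs)) size)
    in (c , d) ∷ ps
     , (ac , db) ∷ proxies
     , (c≢d ∷ All.tabulate (λ v∈ c≡v → avoid v∈ (here (sym c≡v))))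
       ∷ All.tabulate (λ v∈ d≡v → avoid v∈ (there (here (sym d≡v))))
       ∷ u
     , λ { (here refl) → c∉F ; (there (here refl)) → d∉F ; (there (there v∈)) → λ v∈F → avoid v∈ (there (there v∈F)) }

  Bridge : V × V → List V → Set
  Bridge (a , b) σ = IsPath T σ × (∃ λ c → head σ ≡ just c × E T a c) × (∃ λ d → last σ ≡ just d × E T d b)

  bridges-via-proxies : ∀ {rs ps σs} → Pointwise ProxyOf rs ps → Pointwise Connects ps σs → Pointwise Bridge rs σs
  bridges-via-proxies [] [] = []
  bridges-via-proxies {(a , b) ∷ _} {(c , d) ∷ _} ((ac , db) ∷ pxs) ((path , h , l) ∷ cs) =
    (path , (c , h , ac) , (d , l , db)) ∷ bridges-via-proxies pxs cs

  record Bridges (B : List V) (rs : List (V × V)) (σs : List (List V)) : Set where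
    field
      bridge : Pointwise Bridge rs σs
      unique : Unique (concat σs)
      avoid  : ∀ {v} → v ∈ concat σs → v ∉ B

  All-Bridges : ∀ {B rs css} → All (Pointwise Bridge rs) css → Unique (concat (concat css)) →
                (∀ {v} → v ∈ concat (concat css) → v ∉ B) → All (Bridges B rs) css
  All-Bridges {css = css} bs u avoid = All.tabulate λ χ∈ → record
    { bridge = All.lookup bs χ∈
    ; unique = All.lookup us χ∈
    ; avoid  = λ v∈ → let σ , v∈σ , σ∈χ = ∈-concat⁻′ _ v∈ in avoid (∈-concat⁺′ v∈σ (∈-concat⁺′ σ∈χ χ∈))
    }
    where
    us : All (Unique ∘ concat) css
    us = Allₚ.map⁻ (proj₁ (Unique-concat⁻ (map concat css) (subst Unique (sym (concat-concat css)) u)))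

  avoids⇒∉ : ∀ {σs : List (List V)} {ends F} → (∀ {σ v} → σ ∈ σs → v ∈ σ → v ∈ F → v ∈ ends) →
             (∀ {v} → v ∈ ends → v ∉ F) → ∀ {v} → v ∈ concat σs → v ∉ F
  avoids⇒∉ {σs} avoids ends∉F v∈ v∈F with σ , v∈σ , σ∈ ← ∈-concat⁻′ σs v∈ = ends∉F (avoids σ∈ v∈σ v∈F) v∈F

  cheapest-copy : ∀ {M} s → 1 ≤ s → ∀ B rs {ps} → Pointwise ProxyOf (concat (replicate s rs)) ps →
                  (∀ {v} → v ∈ endpoints ps → v ∉ B) → Linkage M ps B →
                  ∃ λ σs → Bridges B rs σs × s * length (concat σs) + 2 * M ≤ n T + 2 * (s * length rs)
  cheapest-copy {M} s 1≤s B rs {ps} proxies ps∉B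
    record { paths = σs ; connects = cs ; disjoint = ds ; avoids = avoids ; short = short }
    with css , refl , length-css , bs ← Pointwise-concat-replicate⁻ s rs (bridges-via-proxies proxies cs)
    with χ , χ-bridges , cheap ← ∃-below-average (length ∘ concat) css
                                   (All-Bridges bs (Unique-concat⁺ (connected-Unique cs) ds) (avoids⇒∉ avoids ps∉B))
                                   (subst (1 ≤_) (sym length-css) 1≤s)
    = χ , χ-bridges , bound
    where
    open ≤-Reasoning
    bound : s * length (concat χ) + 2 * M ≤ n T + 2 * (s * length rs)
    bound = begin
      s * length (concat χ) + 2 * M          ≡⟨ cong (λ k → k * length (concat χ) + 2 * M) length-css ⟨
      length css * length (concat χ) + 2 * M ≤⟨ +-monoˡ-≤ (2 * M) (≤-trans cheap (≤-reflexive (sym (length-concat∘concat css)))) ⟩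
      length (concat (concat css)) + 2 * M   ≤⟨ short ⟩
      n T + 2 * length ps                    ≡⟨ cong (λ k → n T + 2 * k) (trans (sym (Pointwise-length proxies)) (length-concat-replicate s rs)) ⟩
      n T + 2 * (s * length rs)              ∎

  cheap-bridges : ∀ M → Linked' T M → ∀ s → 1 ≤ s → ∀ B rs → All (Request B) rs →
                  ∣ B ∣ᵈ + 2 * (s * length rs) ≤ 2 * M →
                  ∃ λ σs → Bridges B rs σs × s * length (concat σs) + 2 * M ≤ n T + 2 * (s * length rs)
  cheap-bridges M linked s 1≤s B rs reqs size
    with ps , proxies , u , ps∉B ← choose-proxies M linked B (concat (replicate s rs)) (Allₚ.concat⁺ (Allₚ.replicate⁺ s reqs))
                                     (subst (λ k → ∣ B ∣ᵈ + 2 * k ≤ 2 * M) (sym (length-concat-replicate s rs)) size)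
    = cheapest-copy s 1≤s B rs proxies ps∉B (link-avoiding M linked ps B u size′)
    where
    length-ps : length (endpoints ps) ≡ 2 * (s * length rs)
    length-ps = trans (length-endpoints ps) (cong (2 *_) (trans (sym (Pointwise-length proxies)) (length-concat-replicate s rs)))
    size′ : ∣ endpoints ps ++ B ∣ᵈ ≤ 2 * M
    size′ = begin
      ∣ endpoints ps ++ B ∣ᵈ         ≤⟨ ∣∣ᵈ-mono (++-comm-⊆ (endpoints ps)) ⟩
      ∣ B ++ endpoints ps ∣ᵈ         ≤⟨ ∣++∣ᵈ≤ B (endpoints ps) ⟩
      ∣ B ∣ᵈ + length (endpoints ps) ≡⟨ cong (∣ B ∣ᵈ +_) length-ps ⟩
      ∣ B ∣ᵈ + 2 * (s * length rs)   ≤⟨ size ⟩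
      2 * M                          ∎
      where open ≤-Reasoning

  -- Weaving

  -- The default d is never used: all pieces are nonempty paths.
  gaps : V → List (List V) → List (V × V)
  gaps d (A ∷ B ∷ ps) = (fromMaybe d (last A) , fromMaybe d (head B)) ∷ gaps d (B ∷ ps)
  gaps d _            = []

  weave : List (List V) → List (List V) → List V
  weave []           _        = []
  weave (A ∷ [])     _        = A
  weave (A ∷ B ∷ ps) []       = A
  weave (A ∷ B ∷ ps) (σ ∷ σs) = A ++ σ ++ weave (B ∷ ps) σs

  length-gaps : ∀ d A ps → length (gaps d (A ∷ ps)) ≡ length ps
  length-gaps d A []       = refl
  length-gaps d A (B ∷ ps) = cong suc (length-gaps d B ps)

  gaps-Request : ∀ {B} d ps → All (IsPath T) ps → AllPairs VDisjoint ps → (∀ {A} → A ∈ ps → A ⊆ B) →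
                 All (Request B) (gaps d ps)
  gaps-Request d []           _                _          _   = []
  gaps-Request d (A ∷ [])     _                _          _   = []
  gaps-Request d (A ∷ A′ ∷ ps) (pA ∷ pA′ ∷ pps) (dA ∷ dps) ⊆B =
    (⊆B (here refl) a∈A , ⊆B (there (here refl)) b∈A′ , λ a≡b → All.lookup dA (here refl) _ a∈A (subst (_∈ A′) (sym a≡b) b∈A′))
    ∷ gaps-Request d (A′ ∷ ps) (pA′ ∷ pps) dps (⊆B ∘ there)
    where
    a∈A  = last⇒∈ (last≡lastOr d A (proj₂ (proj₂ (proj₂ pA))))
    b∈A′ = head⇒∈ (head≡headOr d A′ (proj₂ (proj₂ (proj₂ pA′))))

  weave-head : ∀ {A a} ps σs → head A ≡ just a → head (weave (A ∷ ps) σs) ≡ just a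
  weave-head     []       σs       h = h
  weave-head     (B ∷ ps) []       h = h
  weave-head {A} (B ∷ ps) (σ ∷ σs) h = head-++ A _ h

  weave-last : ∀ {d B y} ps σs → Pointwise Bridge (gaps d (ps ++ B ∷ [])) σs → last B ≡ just y →
               last (weave (ps ++ B ∷ []) σs) ≡ just y
  weave-last []            σs       _        l = l
  weave-last (A ∷ [])      (σ ∷ σs) (_ ∷ _)  l = last-++ A _ (last-++ σ _ l)
  weave-last (A ∷ A′ ∷ ps) (σ ∷ σs) (_ ∷ bs) l = last-++ A _ (last-++ σ _ (weave-last (A′ ∷ ps) σs bs l))

  weave-∈⁻ : ∀ ps σs {v} → v ∈ weave ps σs → v ∈V ps ⊎ v ∈V σs
  weave-∈⁻ (A ∷ [])     σs       v∈ = inj₁ (here v∈)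
  weave-∈⁻ (A ∷ B ∷ ps) []       v∈ = inj₁ (here v∈)
  weave-∈⁻ (A ∷ B ∷ ps) (σ ∷ σs) v∈ with ∈-++⁻ A v∈
  ... | inj₁ v∈A = inj₁ (here v∈A)
  ... | inj₂ v∈′ with ∈-++⁻ σ v∈′
  ...   | inj₁ v∈σ = inj₂ (here v∈σ)
  ...   | inj₂ v∈W with weave-∈⁻ (B ∷ ps) σs v∈W
  ...     | inj₁ v∈ps = inj₁ (there v∈ps)
  ...     | inj₂ v∈σs = inj₂ (there v∈σs)

  weave-∈⁺ : ∀ {d} ps σs → Pointwise Bridge (gaps d ps) σs → ∀ {A} → A ∈ ps → A ⊆ weave ps σs
  weave-∈⁺ (A ∷ [])     σs       _        (here refl) v∈ = v∈
  weave-∈⁺ (A ∷ B ∷ ps) (σ ∷ σs) _        (here refl) v∈ = ∈-++⁺ˡ v∈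
  weave-∈⁺ (A ∷ B ∷ ps) (σ ∷ σs) (_ ∷ bs) (there A∈)  v∈ = ∈-++⁺ʳ A (∈-++⁺ʳ σ (weave-∈⁺ (B ∷ ps) σs bs A∈ v∈))

  weave-EdgeOf⁺ : ∀ {d} ps σs → Pointwise Bridge (gaps d ps) σs → ∀ {A u v} → A ∈ ps → EdgeOf u v A →
                  EdgeOf u v (weave ps σs)
  weave-EdgeOf⁺ (A ∷ [])     σs       _        (here refl) e = e
  weave-EdgeOf⁺ (A ∷ B ∷ ps) (σ ∷ σs) _        (here refl) e = EdgeOf-++⁺ˡ A e
  weave-EdgeOf⁺ (A ∷ B ∷ ps) (σ ∷ σs) (_ ∷ bs) (there A∈)  e = EdgeOf-++⁺ʳ A (EdgeOf-++⁺ʳ σ (weave-EdgeOf⁺ (B ∷ ps) σs bs A∈ e))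

  weave-EdgeOf⁻ : ∀ {d} ps σs → Pointwise Bridge (gaps d ps) σs → ∀ {u v} → EdgeOf u v (weave ps σs) →
                  EdgeOfSys u v ps ⊎ u ∈V σs ⊎ v ∈V σs
  weave-EdgeOf⁻ (A ∷ [])     σs       _        e = inj₁ (here e)
  weave-EdgeOf⁻ (A ∷ B ∷ ps) (σ ∷ σs) (b ∷ bs) e with EdgeOf-++⁻ A e
  ... | inj₁ eA             = inj₁ (here eA)
  ... | inj₂ (inj₂ (_ , h)) = inj₂ (inj₂ (here (head-++⇒∈ σ (proj₁ (proj₂ (proj₁ (proj₂ b)))) h)))
  ... | inj₂ (inj₁ e′) with EdgeOf-++⁻ σ e′
  ...   | inj₁ eσ              = inj₂ (inj₁ (here (proj₁ (EdgeOf⇒∈ eσ))))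
  ...   | inj₂ (inj₂ (u∈σ , _)) = inj₂ (inj₁ (here u∈σ))
  ...   | inj₂ (inj₁ eW) with weave-EdgeOf⁻ (B ∷ ps) σs bs eW
  ...     | inj₁ e∈ps         = inj₁ (there e∈ps)
  ...     | inj₂ (inj₁ u∈σs)  = inj₂ (inj₁ (there u∈σs))
  ...     | inj₂ (inj₂ v∈σs)  = inj₂ (inj₂ (there v∈σs))

  connected : ∀ (xs ys : List V) {a b} → last xs ≡ just a → head ys ≡ just b → E T a b →
              Connected (E T) (last xs) (head ys)
  connected _ _ l h e rewrite l | h = just e

  weave-Linked : ∀ d ps σs → All (IsPath T) ps → Pointwise Bridge (gaps d ps) σs → Linked (E T) (weave ps σs)
  weave-Linked d []           σs       _               _  = []
  weave-Linked d (A ∷ [])     σs       (pA ∷ _)        _  = proj₁ pA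
  weave-Linked d (A ∷ B ∷ ps) (σ ∷ σs) (pA ∷ pB ∷ pps) ((pσ , (c , hσ , ac) , (e , lσ , eb)) ∷ bs) =
    Linkedₚ.++⁺ (proj₁ pA) (connected A (σ ++ weave (B ∷ ps) σs) (last≡lastOr d A (proj₂ (proj₂ (proj₂ pA)))) (head-++ σ _ hσ) ac)
      (Linkedₚ.++⁺ (proj₁ pσ) (connected σ (weave (B ∷ ps) σs) lσ (weave-head ps σs (head≡headOr d B (proj₂ (proj₂ (proj₂ pB))))) eb)
        (weave-Linked d (B ∷ ps) σs (pB ∷ pps) bs))

  weave-Unique : ∀ d ps σs → All (IsPath T) ps → AllPairs VDisjoint ps → Pointwise Bridge (gaps d ps) σs →
                 AllPairs VDisjoint σs → (∀ {A σ} → A ∈ ps → σ ∈ σs → VDisjoint A σ) → Unique (weave ps σs)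
  weave-Unique d []           σs       _          _          _        _          _     = []
  weave-Unique d (A ∷ [])     σs       (pA ∷ _)   _          _        _          _     = proj₁ (proj₂ pA)
  weave-Unique d (A ∷ B ∷ ps) (σ ∷ σs) (pA ∷ pps) (dA ∷ dps) (b ∷ bs) (dσ ∷ dσs) ps∩σs =
    Uniqueₚ.++⁺ (proj₁ (proj₂ pA)) (Uniqueₚ.++⁺ (proj₁ (proj₂ (proj₁ b))) u-W σ∩W) A∩σW
    where
    W = weave (B ∷ ps) σs
    u-W : Unique W
    u-W = weave-Unique d (B ∷ ps) σs pps dps bs dσs λ A∈ σ∈ → ps∩σs (there A∈) (there σ∈)
    σ∩W : Disjoint σ W
    σ∩W (v∈σ , v∈W) with weave-∈⁻ (B ∷ ps) σs v∈W
    ... | inj₁ v∈ps = let A′ , A′∈ , v∈A′ = find v∈ps in ps∩σs (there A′∈) (here refl) _ v∈A′ v∈σ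
    ... | inj₂ v∈σs = let σ′ , σ′∈ , v∈σ′ = find v∈σs in All.lookup dσ σ′∈ _ v∈σ v∈σ′
    A∩σW : Disjoint A (σ ++ W)
    A∩σW (v∈A , v∈σW) with ∈-++⁻ σ v∈σW
    ... | inj₁ v∈σ = ps∩σs (here refl) (here refl) _ v∈A v∈σ
    ... | inj₂ v∈W with weave-∈⁻ (B ∷ ps) σs v∈W
    ...   | inj₁ v∈ps = let A′ , A′∈ , v∈A′ = find v∈ps in All.lookup dA A′∈ _ v∈A v∈A′
    ...   | inj₂ v∈σs = let σ′ , σ′∈ , v∈σ′ = find v∈σs in ps∩σs (here refl) (there σ′∈) _ v∈A v∈σ′

module Construction (T : Digraph) {k : ℕ} (x y : Fin k → Fin (n T))
    (x-inj : Injective _≡_ _≡_ x) (y-inj : Injective _≡_ _≡_ y) (x≢y : ∀ i j → x i ≢ y j)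
    (Q : Fin k → List (List (Fin (n T)))) (Q-sys : ∀ i → IsPathSystem T (Q i))
    (Q∌xy : ∀ i j v → v ∈V Q i → v ≢ x j × v ≢ y j) where
  private
    V = Fin (n T)

  pieces : Fin k → List (List V)
  pieces i = (x i ∷ []) ∷ Q i ++ (y i ∷ []) ∷ []

  requests : List (V × V)
  requests = concatMap (λ i → gaps T (x i) (pieces i)) (allFin k)

  V[Q] : List V
  V[Q] = concat (concatMap Q (allFin k))

  terminals : List V
  terminals = map x (allFin k) ++ map y (allFin k)

  B : List V
  B = V[Q] ++ terminals

  OnPiece : Fin k → V → Set
  OnPiece i v = v ≡ x i ⊎ v ∈V Q i ⊎ v ≡ y i

  OnPiece⁺ : ∀ i {A v} → A ∈ pieces i → v ∈ A → OnPiece i v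
  OnPiece⁺ i (here refl) (here v≡x) = inj₁ v≡x
  OnPiece⁺ i (there A∈) v∈A with ∈-++⁻ (Q i) A∈
  ... | inj₁ A∈Q            = inj₂ (inj₁ (lose A∈Q v∈A))
  ... | inj₂ (here refl) with v∈A
  ...   | here v≡y = inj₂ (inj₂ v≡y)

  OnPiece⇒∈B : ∀ i {v} → OnPiece i v → v ∈ B
  OnPiece⇒∈B i (inj₁ refl)          = ∈-++⁺ʳ V[Q] (∈-++⁺ˡ (∈-map⁺ x (∈-allFin i)))
  OnPiece⇒∈B i (inj₂ (inj₁ v∈Q))    = let q , q∈ , v∈q = find v∈Q in ∈-++⁺ˡ (∈-concat⁺′ v∈q (∈-concatMap-allFin⁺ Q i q∈))
  OnPiece⇒∈B i (inj₂ (inj₂ refl))   = ∈-++⁺ʳ V[Q] (∈-++⁺ʳ (map x (allFin k)) (∈-map⁺ y (∈-allFin i)))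

  OnPiece-meet : ∀ {i j v} → i ≢ j → OnPiece i v → OnPiece j v → v ∈V Q i × v ∈V Q j
  OnPiece-meet {i} {j} i≢j (inj₁ refl)       (inj₁ x≡x)       = ⊥-elim (i≢j (x-inj x≡x))
  OnPiece-meet {i} {j} i≢j (inj₁ refl)       (inj₂ (inj₁ v∈)) = ⊥-elim (proj₁ (Q∌xy j i _ v∈) refl)
  OnPiece-meet {i} {j} i≢j (inj₁ refl)       (inj₂ (inj₂ x≡y)) = ⊥-elim (x≢y i j x≡y)
  OnPiece-meet {i} {j} i≢j (inj₂ (inj₁ v∈))  (inj₁ refl)       = ⊥-elim (proj₁ (Q∌xy i j _ v∈) refl)
  OnPiece-meet {i} {j} i≢j (inj₂ (inj₁ v∈))  (inj₂ (inj₁ v∈′)) = v∈ , v∈′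
  OnPiece-meet {i} {j} i≢j (inj₂ (inj₁ v∈))  (inj₂ (inj₂ refl)) = ⊥-elim (proj₂ (Q∌xy i j _ v∈) refl)
  OnPiece-meet {i} {j} i≢j (inj₂ (inj₂ refl)) (inj₁ y≡x)       = ⊥-elim (x≢y j i (sym y≡x))
  OnPiece-meet {i} {j} i≢j (inj₂ (inj₂ refl)) (inj₂ (inj₁ v∈)) = ⊥-elim (proj₂ (Q∌xy j i _ v∈) refl)
  OnPiece-meet {i} {j} i≢j (inj₂ (inj₂ refl)) (inj₂ (inj₂ y≡y)) = ⊥-elim (i≢j (y-inj y≡y))

  pieces-paths : ∀ i → All (IsPath T) (pieces i)
  pieces-paths i = singleton (x i) ∷ Allₚ.++⁺ (All.tabulate (proj₁ (Q-sys i) _)) (singleton (y i) ∷ [])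
    where
    singleton : ∀ v → IsPath T (v ∷ [])
    singleton v = [-] , [] ∷ [] , v , refl

  pieces-disjoint : ∀ i → AllPairs VDisjoint (pieces i)
  pieces-disjoint i = All.tabulate x∉ ∷ AllPairsₚ.++⁺ (proj₂ (Q-sys i)) ([] ∷ []) (All.tabulate λ q∈ → y∉ q∈ ∷ [])
    where
    x∉ : ∀ {A} → A ∈ Q i ++ (y i ∷ []) ∷ [] → VDisjoint (x i ∷ []) A
    x∉ A∈ _ (here refl) v∈A with ∈-++⁻ (Q i) A∈
    ... | inj₁ A∈Q = proj₁ (Q∌xy i i _ (lose A∈Q v∈A)) refl
    ... | inj₂ (here refl) with v∈A
    ...   | here x≡y = x≢y i i x≡y
    y∉ : ∀ {q} → q ∈ Q i → VDisjoint q (y i ∷ [])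
    y∉ q∈ _ v∈q (here refl) = proj₂ (Q∌xy i i _ (lose q∈ v∈q)) refl

  requests-valid : All (Request T B) requests
  requests-valid = All.tabulate λ r∈ →
    let i , r∈i = ∈-concatMap-allFin⁻ (λ i → gaps T (x i) (pieces i)) r∈ in
    All.lookup (gaps-Request T (x i) (pieces i) (pieces-paths i) (pieces-disjoint i)
                 λ A∈ v∈A → OnPiece⇒∈B i (OnPiece⁺ i A∈ v∈A)) r∈i

  length-requests : length requests ≡ k + sum (map (λ i → length (Q i)) (allFin k))
  length-requests = trans (length-concatMap (allFin k)) (cong (_+ sum (map (λ i → length (Q i)) (allFin k))) (length-allFin {k}))
    where
    open +-*-Solver
    length-concatMap : ∀ is → length (concatMap (λ i → gaps T (x i) (pieces i)) is) ≡ length is + sum (map (λ i → length (Q i)) is)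
    length-concatMap []       = refl
    length-concatMap (i ∷ is) = begin
      length (gaps T (x i) (pieces i) ++ concatMap _ is)          ≡⟨ length-++ (gaps T (x i) (pieces i)) ⟩
      length (gaps T (x i) (pieces i)) + length (concatMap _ is)  ≡⟨ cong₂ _+_ (trans (length-gaps T (x i) _ (Q i ++ _)) (length-++ (Q i))) (length-concatMap is) ⟩
      (length (Q i) + 1) + (length is + sum (map _ is))           ≡⟨ solve 3 (λ q l r → (q :+ con 1) :+ (l :+ r) := con 1 :+ (l :+ (q :+ r))) refl (length (Q i)) (length is) (sum (map (λ i → length (Q i)) is)) ⟩
      suc (length is + (length (Q i) + sum (map _ is)))           ∎
      where open ≡-Reasoning

  length-terminals : length terminals ≡ k + k
  length-terminals = trans (length-++ (map x (allFin k)))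
    (cong₂ _+_ (trans (length-map x (allFin k)) (length-allFin {k})) (trans (length-map y (allFin k)) (length-allFin {k})))

  ∣B∣ᵈ≤ : ∣ B ∣ᵈ ≤ ∣ V[Q] ∣ᵈ + (k + k)
  ∣B∣ᵈ≤ = ≤-trans (∣++∣ᵈ≤ V[Q] terminals) (+-monoʳ-≤ ∣ V[Q] ∣ᵈ (≤-reflexive length-terminals))

  module WithBridges (bridges : Fin k → List (List V))
               (bridge : ∀ i → Pointwise (Bridge T) (gaps T (x i) (pieces i)) (bridges i))
               (unique : Unique (concatMap (concat ∘ bridges) (allFin k)))
               (avoid  : ∀ {v} → v ∈ concatMap (concat ∘ bridges) (allFin k) → v ∉ B) where

    P : Fin k → List V
    P i = weave T (pieces i) (bridges i)

    bridges-unique = Unique-concatMap-allFin⁻ k (concat ∘ bridges) unique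

    bridge-∉B : ∀ i {v} → v ∈ concat (bridges i) → v ∉ B
    bridge-∉B i v∈ = avoid (∈-concatMap-allFin⁺ (concat ∘ bridges) i v∈)

    P-∈⁻ : ∀ i {v} → v ∈ P i → OnPiece i v ⊎ v ∈ concat (bridges i)
    P-∈⁻ i v∈ with weave-∈⁻ T (pieces i) (bridges i) v∈
    ... | inj₁ v∈pieces  = let A , A∈ , v∈A = find v∈pieces in inj₁ (OnPiece⁺ i A∈ v∈A)
    ... | inj₂ v∈bridges = let σ , σ∈ , v∈σ = find v∈bridges in inj₂ (∈-concat⁺′ v∈σ σ∈)

    P-path : ∀ i → PathFrom T (x i) (y i) (P i)
    P-path i = (weave-Linked T (x i) (pieces i) (bridges i) (pieces-paths i) (bridge i)
             , weave-Unique T (x i) (pieces i) (bridges i) (pieces-paths i) (pieces-disjoint i) (bridge i)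
                 (proj₂ (Unique-concat⁻ (bridges i) (proj₁ bridges-unique i)))
                 (λ A∈ σ∈ v v∈A v∈σ → bridge-∉B i (∈-concat⁺′ v∈σ σ∈) (OnPiece⇒∈B i (OnPiece⁺ i A∈ v∈A)))
             , x i , head-P)
             , head-P
             , weave-last T ((x i ∷ []) ∷ Q i) (bridges i) (bridge i) refl
      where
      head-P = weave-head T (Q i ++ (y i ∷ []) ∷ []) (bridges i) refl

    Q⊆P : ∀ i q → q ∈ Q i → SubPath q (P i)
    Q⊆P i q q∈ = (λ _ → weave-∈⁺ T (pieces i) (bridges i) (bridge i) (there (∈-++⁺ˡ q∈)))
               , (λ _ _ → weave-EdgeOf⁺ T (pieces i) (bridges i) (bridge i) (there (∈-++⁺ˡ q∈)))

    P-meet : ∀ i j → i ≢ j → ∀ v → v ∈ P i → v ∈ P j → v ∈V Q i × v ∈V Q j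
    P-meet i j i≢j v v∈Pi v∈Pj with P-∈⁻ i v∈Pi | P-∈⁻ j v∈Pj
    ... | inj₁ on-i  | inj₁ on-j  = OnPiece-meet i≢j on-i on-j
    ... | inj₁ on-i  | inj₂ v∈bj  = ⊥-elim (bridge-∉B j v∈bj (OnPiece⇒∈B i on-i))
    ... | inj₂ v∈bi  | inj₁ on-j  = ⊥-elim (bridge-∉B i v∈bi (OnPiece⇒∈B j on-j))
    ... | inj₂ v∈bi  | inj₂ v∈bj  = ⊥-elim (i≢j (proj₂ bridges-unique i j v∈bi v∈bj))

    shared⇒∉bridges : ∀ i j → i ≢ j → ∀ {w} → w ∈ P i → w ∈ P j → ¬ (w ∈V bridges i)
    shared⇒∉bridges i j i≢j w∈Pi w∈Pj w∈ = let σ , σ∈ , w∈σ = find w∈ in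
      bridge-∉B i (∈-concat⁺′ w∈σ σ∈) (OnPiece⇒∈B i (inj₂ (inj₁ (proj₁ (P-meet i j i≢j _ w∈Pi w∈Pj)))))

    shared-edge∈Q : ∀ i j → i ≢ j → ∀ {u v} → EdgeOf u v (P i) → EdgeOf u v (P j) → EdgeOfSys u v (Q i)
    shared-edge∈Q i j i≢j {u} {v} e e′ with weave-EdgeOf⁻ T (pieces i) (bridges i) (bridge i) e
    ... | inj₁ e∈pieces         = piece-edge e∈pieces
      where
      piece-edge : EdgeOfSys u v (pieces i) → EdgeOfSys u v (Q i)
      piece-edge (here (there ()))
      piece-edge (there e∈) with Anyₚ.++⁻ (Q i) e∈
      ... | inj₁ e∈Q = e∈Q
      ... | inj₂ (here (there ()))
    ... | inj₂ (inj₁ u∈bridges) = ⊥-elim (shared⇒∉bridges i j i≢j (proj₁ (EdgeOf⇒∈ e)) (proj₁ (EdgeOf⇒∈ e′)) u∈bridges)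
    ... | inj₂ (inj₂ v∈bridges) = ⊥-elim (shared⇒∉bridges i j i≢j (proj₂ (EdgeOf⇒∈ e)) (proj₂ (EdgeOf⇒∈ e′)) v∈bridges)

    P-edge-disjoint : (∀ i j → i ≢ j → ∀ u v → EdgeOfSys u v (Q i) → ¬ EdgeOfSys u v (Q j)) →
                      ∀ i j → i ≢ j → ∀ u v → EdgeOf u v (P i) → ¬ EdgeOf u v (P j)
    P-edge-disjoint Q-edges i j i≢j u v e e′ =
      Q-edges i j i≢j u v (shared-edge∈Q i j i≢j e e′) (shared-edge∈Q j i (i≢j ∘ sym) e′ e)

    ∣⋃P∣ᵈ≤ : ∣ concatMap P (allFin k) ∣ᵈ ≤ ∣ V[Q] ∣ᵈ + (k + k + length (concatMap (concat ∘ bridges) (allFin k)))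
    ∣⋃P∣ᵈ≤ = ≤-trans (∣∣ᵈ-mono ⋃P⊆) (≤-trans (∣++∣ᵈ≤ V[Q] _) (+-monoʳ-≤ ∣ V[Q] ∣ᵈ (≤-reflexive
      (trans (length-++ terminals) (cong (_+ length (concatMap (concat ∘ bridges) (allFin k))) length-terminals)))))
      where
      ⋃P⊆ : concatMap P (allFin k) ⊆ V[Q] ++ terminals ++ concatMap (concat ∘ bridges) (allFin k)
      ⋃P⊆ v∈ with i , v∈Pi ← ∈-concatMap-allFin⁻ P v∈ with P-∈⁻ i v∈Pi
      ... | inj₂ v∈bi = ∈-++⁺ʳ V[Q] (∈-++⁺ʳ terminals (∈-concatMap-allFin⁺ (concat ∘ bridges) i v∈bi))
      ... | inj₁ on-i with ∈-++⁻ V[Q] (OnPiece⇒∈B i on-i)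
      ...   | inj₁ v∈VQ = ∈-++⁺ˡ v∈VQ
      ...   | inj₂ v∈ts = ∈-++⁺ʳ V[Q] (∈-++⁺ˡ v∈ts)

lemma8p2 : (s : ℕ) → 1 ≤ s → (T : Digraph) → (k : ℕ)
    → (x y : Fin k → Fin (n T))
    → Injective _≡_ _≡_ x → Injective _≡_ _≡_ y → (∀ i j → x i ≢ y j)
    → (Q : Fin k → List (List (Fin (n T))))
    → (∀ i → IsPathSystem T (Q i))
    → (∀ i j v → v ∈V Q i → v ≢ x j × v ≢ y j)
    → (∀ i j → i ≢ j → ∀ u v → EdgeOfSys u v (Q i) → ¬ EdgeOfSys u v (Q j))
    → Linked' T (2 * s * (k + sum (map (λ i → length (Q i)) (allFin k))
                           + ∣ concat (concatMap Q (allFin k)) ∣ᵈ))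
    → ∃ λ (P : Fin k → List (Fin (n T))) →
        (∀ i j → i ≢ j → ∀ u v → EdgeOf u v (P i) → ¬ EdgeOf u v (P j))
        × (∀ i → PathFrom T (x i) (y i) (P i))
        × (∀ i q → q ∈ Q i → SubPath q (P i))
        × (∀ i j → i ≢ j → ∀ v → v ∈ P i → v ∈ P j → v ∈V Q i × v ∈V Q j)
        × (s * ∣ concatMap P (allFin k) ∣ᵈ
             ≤ ∣ T ∣ᵥ + s * ∣ concat (concatMap Q (allFin k)) ∣ᵈ)
lemma8p2 s 1≤s T k x y x-inj y-inj x≢y Q Q-sys Q∌xy Q-edges linked =
  let open Construction T x y x-inj y-inj x≢y Q Q-sys Q∌xy
      g = k + sum (map (λ i → length (Q i)) (allFin k))
      w = ∣ V[Q] ∣ᵈ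
      χ , χ-bridges , cheap = cheap-bridges T (2 * s * (g + w)) linked s 1≤s B requests requests-valid
        (subst (λ r → ∣ B ∣ᵈ + 2 * (s * r) ≤ 2 * (2 * s * (g + w))) (sym length-requests)
          (≤-trans (+-monoˡ-≤ (2 * (s * g)) ∣B∣ᵈ≤) (size-for-bridges s k g w 1≤s (m≤m+n k _))))
      bridges , bridge , χ≡bridges = Pointwise-concatMap-allFin⁻ k _ (Bridges.bridge χ-bridges)
      χ≡ = trans (cong concat χ≡bridges) (concat∘concatMap bridges (allFin k))
      open WithBridges bridges bridge (subst Unique χ≡ (Bridges.unique χ-bridges))
                 (Bridges.avoid χ-bridges ∘ subst (_ ∈_) (sym χ≡))
  in P , P-edge-disjoint Q-edges , P-path , Q⊆P , P-meet
   , size-of-union s k g w _ _ (n T) (m≤m+n k _) ∣⋃P∣ᵈ≤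
       (subst₂ (λ c r → s * length c + 2 * (2 * s * (g + w)) ≤ n T + 2 * (s * r)) χ≡ length-requests cheap)
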